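{- Let $k$ be a nonnegative integer and let $G=(V_G,E_G)$ and $H=(V_H,E_H)$ be graphs. Let $A\subseteq V_G$ and $B\subseteq V_H$ be such that (i) $G-A=H-B$ and (ii) $N_G[A]\setminus A=N_H[B]\setminus B$. Let $P\subseteq V_G\setminus A=V_H\setminus B$. Then 1) $A\cup P$ is a $k$-power dominating set of $G$ if and only if $B\cup P$ is a $k$-power dominating set of $H$; 2) $N_G[A]\cup P$ is a $k$-forcing set of $G$ if and only if $N_H[B]\cup P$ is a $k$-forcing set of $H$.
   Context: Graphs are finite, simple and undirected; $N_G[S]=\bigcup_{v\in S}(N_G(v)\cup\{v\})$; $G-A$ is the subgraph induced by $V_G\setminus A$. For a graph $G=(V,E)$, nonnegative integer $k$ and $T\subseteq V$: $\mathscr F^0_{G,k}(T)=T$, $\mathscr F^{i+1}_{G,k}(T)=\mathscr F^i_{G,k}(T)\cup\bigcup\{N(v): v\in \mathscr F^i_{G,k}(T),\ 1\le |N(v)\setminus \mathscr F^i_{G,k}(T)|\le k\}$; $T$ is a $k$-forcing set of $G$ if $\mathscr F^t_{G,k}(T)=V$ for some $t$. $\mathscr P^0_{G,k}(S)=N[S]$ with $\mathscr P^{i+1}_{G,k}(S)$ defined by the same rule; $S$ is a $k$-power dominating set of $G$ if $\mathscr P^\ell_{G,k}(S)=V$ for some $\ell$. -}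

module Defs where

open import Data.Nat using (ℕ; zero; suc; _≤ᵇ_)
open import Data.Bool using (Bool; true; false; _∧_; _∨_)
open import Data.Fin using (Fin)
open import Data.Vec using (tabulate; lookup)
open import Data.Fin.Subset using (Subset; _∈_; _⊆_; _∪_; _─_; ∣_∣)
open import Data.Product using (Σ; _×_)
open import Relation.Binary.PropositionalEquality using (_≡_)

-- Finite simple undirected graphs whose vertex sets are subsets of a
-- common finite universe Fin n (so two graphs can share vertices).
record Graph (n : ℕ) : Set where
  field
    V      : Subset n
    adj    : Fin n → Fin n → Bool
    sym    : ∀ u v → adj u v ≡ adj v u
    irrefl : ∀ v → adj v v ≡ false
    closed : ∀ u v → adj u v ≡ true → (u ∈ V) × (v ∈ V)
open Graph public

anyFin : ∀ {n} → (Fin n → Bool) → Bool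
anyFin {zero}  f = false
anyFin {suc n} f = f Fin.zero ∨ anyFin (λ i → f (Fin.suc i))

N : ∀ {n} → Graph n → Fin n → Subset n
N G v = tabulate (λ u → adj G v u)

N[_] : ∀ {n} → Graph n → Subset n → Subset n
N[ G ] S = tabulate (λ u → lookup S u ∨ anyFin (λ v → lookup S v ∧ adj G v u))

active : ∀ {n} → Graph n → ℕ → Subset n → Fin n → Bool
active G k F v = lookup F v ∧ ((1 ≤ᵇ ∣ N G v ─ F ∣) ∧ (∣ N G v ─ F ∣ ≤ᵇ k))

step : ∀ {n} → Graph n → ℕ → Subset n → Subset n
step G k F = tabulate (λ u → lookup F u ∨ anyFin (λ v → active G k F v ∧ adj G v u))

iter : ∀ {n} → Graph n → ℕ → ℕ → Subset n → Subset n
iter G k zero    T = T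
iter G k (suc i) T = step G k (iter G k i T)

IsKForcing : ∀ {n} → Graph n → ℕ → Subset n → Set
IsKForcing G k T = (T ⊆ V G) × Σ ℕ (λ t → iter G k t T ≡ V G)

IsKPowerDominating : ∀ {n} → Graph n → ℕ → Subset n → Set
IsKPowerDominating G k S = (S ⊆ V G) × Σ ℕ (λ ℓ → iter G k ℓ (N[ G ] S) ≡ V G)

DeleteEq : ∀ {n} → Graph n → Subset n → Graph n → Subset n → Set
DeleteEq G A H B =
  (V G ─ A ≡ V H ─ B) ×
  (∀ u v → u ∈ V G ─ A → v ∈ V G ─ A → adj G u v ≡ adj H u v)

-- Put W = V_G ∖ A = V_H ∖ B. As long as the coloured set F contains N[A], no vertex
-- of A can force: all its neighbours are already coloured. A vertex v of W has the
-- same neighbours in W in both graphs, and its neighbours outside W lie in A ⊆ F, so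
-- whether v forces, and which vertices it colours, depends only on F ∩ W. Hence the
-- k-forcing processes started from N[A] ∪ X in G and from N[B] ∪ Y in H colour the
-- same vertices of W at every step as soon as X and Y agree on W, and one of them
-- fills its graph exactly when the other does. Both parts of the theorem are
-- instances: X = Y = P, and, since N[A ∪ P] = N[A] ∪ N[P], X = N_G[P], Y = N_H[P].
module Submission where

open import Defs
open import Data.Nat using (ℕ)
open import Data.Fin.Subset using (Subset; _⊆_; _∪_; _─_)
open import Data.Product using (_×_)
open import Relation.Binary.PropositionalEquality using (_≡_)
open import Function.Bundles using (_⇔_)

open import Algebra.Bundles using (CommutativeMonoid)
open import Data.Nat using (_≤ᵇ_)
open import Data.Bool using (Bool; true; false; _∧_; _∨_)
open import Data.Bool.Properties using (∧-zeroʳ; ∨-zeroʳ; ∧-distribʳ-∨; ∨-commutativeMonoid)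
open import Data.Fin using (Fin; zero; suc)
open import Data.Fin.Subset using (_∈_; _∉_; ∣_∣; inside; outside)
open import Data.Fin.Subset.Properties
  using (_∈?_; ⊆-trans; ⊆-antisym; p⊆p∪q; x∈p∪q⁻; x∈p∧x∉q⇒x∈p─q; p─q⊆p; Empty-unique; ∣⊥∣≡0)
open import Data.Product using (∃; _,_; proj₁; proj₂)
open import Data.Sum using ([_,_])
open import Data.Vec using (_∷_; lookup; here; there)
open import Data.Vec.Properties
  using (lookup∘tabulate; tabulate∘lookup; tabulate-cong; lookup-zipWith; []=⇒lookup; lookup⇒[]=)
open import Function.Bundles using (mk⇔)
open import Relation.Nullary using (yes; no)
open import Relation.Nullary.Negation using (contradiction)
import Relation.Binary.PropositionalEquality as ≡
open ≡ using (refl; trans; cong; cong₂; subst)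
open ≡.≡-Reasoning

open import Algebra.Properties.CommutativeSemigroup
  (CommutativeMonoid.commutativeSemigroup ∨-commutativeMonoid) using (interchange)

private
  variable
    n : ℕ
    p q r : Subset n

lookup-∉ : ∀ {x} → x ∉ p → lookup p x ≡ false
lookup-∉ {p = p} {x} x∉p with lookup p x in eq
... | false = refl
... | true  = contradiction (lookup⇒[]= x p eq) x∉p

lookup-ext : (∀ x → lookup p x ≡ lookup q x) → p ≡ q
lookup-ext {p = p} {q} eq =
  trans (≡.sym (tabulate∘lookup p)) (trans (tabulate-cong eq) (tabulate∘lookup q))

x∈p─q⇒x∉q : ∀ (p q : Subset n) {x} → x ∈ p ─ q → x ∉ q
x∈p─q⇒x∉q (_ ∷ p) (_ ∷ q) (there x∈p─q) (there x∈q) = x∈p─q⇒x∉q p q x∈p─q x∈q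

lookup-─-∉ : ∀ (p q : Subset n) {x} → x ∉ q → lookup (p ─ q) x ≡ lookup p x
lookup-─-∉ (_ ∷ p) (outside ∷ q) {zero}  x∉q = refl
lookup-─-∉ (_ ∷ p) (inside ∷ q)  {zero}  x∉q = contradiction here x∉q
lookup-─-∉ (_ ∷ p) (_ ∷ q)       {suc x} x∉q = lookup-─-∉ p q (λ x∈q → x∉q (there x∈q))

lookup-─-cong : ∀ (p q p′ q′ : Subset n) x →
  lookup p x ≡ lookup p′ x → lookup q x ≡ lookup q′ x → lookup (p ─ q) x ≡ lookup (p′ ─ q′) x
lookup-─-cong (_ ∷ _) (_ ∷ _) (_ ∷ _) (_ ∷ _) zero refl refl = refl
lookup-─-cong (_ ∷ p) (_ ∷ q) (_ ∷ p′) (_ ∷ q′) (suc x) = lookup-─-cong p q p′ q′ x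

∪-⊆ : p ⊆ r → q ⊆ r → p ∪ q ⊆ r
∪-⊆ {p = p} {q = q} p⊆r q⊆r x∈p∪q = [ p⊆r , q⊆r ] (x∈p∪q⁻ p q x∈p∪q)

Agree : Subset n → Subset n → Subset n → Set
Agree W p q = ∀ {x} → x ∈ W → lookup p x ≡ lookup q x

agree⇒≡ : ∀ {W : Subset n} → p ⊆ W → q ⊆ W → Agree W p q → p ≡ q
agree⇒≡ {p = p} {q} {W} p⊆W q⊆W agree = lookup-ext pointwise
  where
  pointwise : ∀ x → lookup p x ≡ lookup q x
  pointwise x with x ∈? W
  ... | yes x∈W = agree x∈W
  ... | no  x∉W = trans (lookup-∉ (λ x∈p → x∉W (p⊆W x∈p))) (≡.sym (lookup-∉ (λ x∈q → x∉W (q⊆W x∈q))))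

anyFin-cong : {f g : Fin n → Bool} → (∀ i → f i ≡ g i) → anyFin f ≡ anyFin g
anyFin-cong {ℕ.zero}  eq = refl
anyFin-cong {ℕ.suc n} eq = cong₂ _∨_ (eq zero) (anyFin-cong (λ i → eq (suc i)))

anyFin⁺ : (f : Fin n → Bool) (i : Fin n) → f i ≡ true → anyFin f ≡ true
anyFin⁺ f zero    fi = cong (_∨ anyFin (λ i → f (suc i))) fi
anyFin⁺ f (suc i) fi = trans (cong (f zero ∨_) (anyFin⁺ (λ j → f (suc j)) i fi)) (∨-zeroʳ (f zero))

anyFin⁻ : (f : Fin n → Bool) → anyFin f ≡ true → ∃ λ i → f i ≡ true
anyFin⁻ {ℕ.suc n} f any with f zero in f0
... | true  = zero , f0
... | false with anyFin⁻ (λ i → f (suc i)) any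
...   | i , fi = suc i , fi

anyFin-∨ : (f g : Fin n → Bool) → anyFin (λ i → f i ∨ g i) ≡ anyFin f ∨ anyFin g
anyFin-∨ {ℕ.zero}  f g = refl
anyFin-∨ {ℕ.suc n} f g = begin
  (f zero ∨ g zero) ∨ anyFin (λ i → f (suc i) ∨ g (suc i))
    ≡⟨ cong ((f zero ∨ g zero) ∨_) (anyFin-∨ (λ i → f (suc i)) (λ i → g (suc i))) ⟩
  (f zero ∨ g zero) ∨ (anyFin (λ i → f (suc i)) ∨ anyFin (λ i → g (suc i)))
    ≡⟨ interchange (f zero) (g zero) _ _ ⟩
  (f zero ∨ anyFin (λ i → f (suc i))) ∨ (g zero ∨ anyFin (λ i → g (suc i))) ∎

∧-true⇒ʳ : ∀ {x y} → x ∧ y ≡ true → y ≡ true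
∧-true⇒ʳ {true} y≡true = y≡true

module _ (G : Graph n) where

  reaches : Subset n → Fin n → Bool
  reaches S u = anyFin (λ v → lookup S v ∧ adj G v u)

  ∈N⇒adj : ∀ {u v} → u ∈ N G v → adj G v u ≡ true
  ∈N⇒adj {u} m = trans (≡.sym (lookup∘tabulate _ u)) ([]=⇒lookup m)

  N⊆V : ∀ v → N G v ⊆ V G
  N⊆V v {u} m = proj₂ (closed G v u (∈N⇒adj m))

  ⊆N[] : ∀ S → S ⊆ N[ G ] S
  ⊆N[] S {u} u∈S = lookup⇒[]= u (N[ G ] S) (trans (lookup∘tabulate _ u) (cong (_∨ reaches S u) ([]=⇒lookup u∈S)))

  N⊆N[] : ∀ {S v} → v ∈ S → N G v ⊆ N[ G ] S
  N⊆N[] {S} {v} v∈S {u} u∈Nv = lookup⇒[]= u _ (begin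
    lookup (N[ G ] S) u                                       ≡⟨ lookup∘tabulate _ u ⟩
    lookup S u ∨ reaches S u                                  ≡⟨ cong (lookup S u ∨_) (anyFin⁺ _ v v→u) ⟩
    lookup S u ∨ true                                         ≡⟨ ∨-zeroʳ _ ⟩
    true                                                      ∎)
    where
    v→u : lookup S v ∧ adj G v u ≡ true
    v→u = cong₂ _∧_ ([]=⇒lookup v∈S) (∈N⇒adj u∈Nv)

  -- Both N[S] and a forcing step have this shape: F together with some neighbours.
  grown-⊆V : ∀ {F u} (g : Fin n → Bool) → F ⊆ V G →
    lookup F u ∨ anyFin (λ v → g v ∧ adj G v u) ≡ true → u ∈ V G
  grown-⊆V {F} {u} g F⊆V grown with lookup F u in Fu
  ... | true  = F⊆V (lookup⇒[]= u F Fu)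
  ... | false with anyFin⁻ _ grown
  ...   | v , v→u = proj₂ (closed G v u (∧-true⇒ʳ v→u))

  N[]-⊆V : ∀ {S} → S ⊆ V G → N[ G ] S ⊆ V G
  N[]-⊆V {S} S⊆V {u} m = grown-⊆V (lookup S) S⊆V (trans (≡.sym (lookup∘tabulate _ u)) ([]=⇒lookup m))

  N[]-∪ : ∀ S T → N[ G ] (S ∪ T) ≡ N[ G ] S ∪ N[ G ] T
  N[]-∪ S T = lookup-ext λ u → begin
    lookup (N[ G ] (S ∪ T)) u
      ≡⟨ lookup∘tabulate _ u ⟩
    lookup (S ∪ T) u ∨ reaches (S ∪ T) u
      ≡⟨ cong₂ _∨_ (lookup-zipWith _∨_ u S T) (anyFin-cong λ v →
           trans (cong (_∧ adj G v u) (lookup-zipWith _∨_ v S T)) (∧-distribʳ-∨ _ (lookup S v) _)) ⟩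
    (lookup S u ∨ lookup T u) ∨ anyFin (λ v → (lookup S v ∧ adj G v u) ∨ (lookup T v ∧ adj G v u))
      ≡⟨ cong ((lookup S u ∨ lookup T u) ∨_) (anyFin-∨ (λ v → lookup S v ∧ adj G v u) _) ⟩
    (lookup S u ∨ lookup T u) ∨ (reaches S u ∨ reaches T u)
      ≡⟨ interchange (lookup S u) (lookup T u) (reaches S u) (reaches T u) ⟩
    (lookup S u ∨ reaches S u) ∨ (lookup T u ∨ reaches T u)
      ≡⟨ cong₂ _∨_ (lookup∘tabulate _ u) (lookup∘tabulate _ u) ⟨
    lookup (N[ G ] S) u ∨ lookup (N[ G ] T) u
      ≡⟨ lookup-zipWith _∨_ u (N[ G ] S) (N[ G ] T) ⟨
    lookup (N[ G ] S ∪ N[ G ] T) u ∎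

  module _ (k : ℕ) where

    step-inflationary : ∀ {F} → F ⊆ step G k F
    step-inflationary {F} {u} u∈F =
      lookup⇒[]= u (step G k F)
        (trans (lookup∘tabulate _ u) (cong (_∨ anyFin (λ v → active G k F v ∧ adj G v u)) ([]=⇒lookup u∈F)))

    step-⊆V : ∀ {F} → F ⊆ V G → step G k F ⊆ V G
    step-⊆V {F} F⊆V {u} m =
      grown-⊆V (active G k F) F⊆V (trans (≡.sym (lookup∘tabulate _ u)) ([]=⇒lookup m))

    iter-inflationary : ∀ {F} t → F ⊆ iter G k t F
    iter-inflationary ℕ.zero    = λ u∈F → u∈F
    iter-inflationary (ℕ.suc t) = ⊆-trans (iter-inflationary t) step-inflationary

    iter-⊆V : ∀ {F} t → F ⊆ V G → iter G k t F ⊆ V G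
    iter-⊆V ℕ.zero    F⊆V = F⊆V
    iter-⊆V (ℕ.suc t) F⊆V = step-⊆V (iter-⊆V t F⊆V)

    inactive : ∀ {F v} → N G v ⊆ F → active G k F v ≡ false
    inactive {F} {v} N⊆F = trans (cong (λ m → lookup F v ∧ ((1 ≤ᵇ m) ∧ (m ≤ᵇ k))) no-unforced) (∧-zeroʳ _)
      where
      no-unforced : ∣ N G v ─ F ∣ ≡ 0
      no-unforced = trans (cong ∣_∣ (Empty-unique λ (u , u∈) → x∈p─q⇒x∉q (N G v) F u∈ (N⊆F (p─q⊆p (N G v) F u∈))))
                          (∣⊥∣≡0 n)

  N─⊆V─ : ∀ {A F v} → A ⊆ F → N G v ─ F ⊆ V G ─ A
  N─⊆V─ A⊆F u∈ = x∈p∧x∉q⇒x∈p─q (N⊆V _ (p─q⊆p _ _ u∈)) (λ u∈A → x∈p─q⇒x∉q _ _ u∈ (A⊆F u∈A))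

  -- Off V ∖ A a vertex is either in A, with its neighbours in N[A], or outside V, isolated.
  N⊆-off : ∀ {A F v} → N[ G ] A ⊆ F → v ∉ V G ─ A → N G v ⊆ F
  N⊆-off {A} {v = v} N[A]⊆F v∉W {u} u∈Nv with v ∈? A
  ... | yes v∈A = N[A]⊆F (N⊆N[] v∈A u∈Nv)
  ... | no  v∉A = contradiction (x∈p∧x∉q⇒x∈p─q (proj₁ (closed G v u (∈N⇒adj u∈Nv))) v∉A) v∉W

DeleteEq-sym : ∀ {G H : Graph n} {A B} → DeleteEq G A H B → DeleteEq H B G A
DeleteEq-sym (W≡ , adj≡) =
  ≡.sym W≡ , λ u v u∈ v∈ → ≡.sym (adj≡ u v (subst (u ∈_) (≡.sym W≡) u∈) (subst (v ∈_) (≡.sym W≡) v∈))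

module Exchange (k : ℕ) (G H : Graph n) (A B : Subset n)
  (G-A≡H-B : DeleteEq G A H B) (∂A≡∂B : N[ G ] A ─ A ≡ N[ H ] B ─ B) where

  W : Subset n
  W = V G ─ A

  W≡V─B : W ≡ V H ─ B
  W≡V─B = proj₁ G-A≡H-B

  ∈W⇒∈V─B : ∀ {u} → u ∈ W → u ∈ V H ─ B
  ∈W⇒∈V─B = subst (_ ∈_) W≡V─B

  adj-agree : ∀ {u v} → u ∈ W → v ∈ W → adj G u v ≡ adj H u v
  adj-agree = proj₂ G-A≡H-B _ _

  N[]-agree : ∀ {P} → P ⊆ W → Agree W (N[ G ] P) (N[ H ] P)
  N[]-agree {P} P⊆W {u} u∈W = begin
    lookup (N[ G ] P) u                              ≡⟨ lookup∘tabulate _ u ⟩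
    lookup P u ∨ anyFin (λ v → lookup P v ∧ adj G v u) ≡⟨ cong (lookup P u ∨_) (anyFin-cong edge) ⟩
    lookup P u ∨ anyFin (λ v → lookup P v ∧ adj H v u) ≡⟨ lookup∘tabulate _ u ⟨
    lookup (N[ H ] P) u                              ∎
    where
    edge : ∀ v → lookup P v ∧ adj G v u ≡ lookup P v ∧ adj H v u
    edge v with lookup P v in Pv
    ... | true  = adj-agree (P⊆W (lookup⇒[]= v P Pv)) u∈W
    ... | false = refl

  boundary-agree : Agree W (N[ G ] A) (N[ H ] B)
  boundary-agree {u} u∈W = begin
    lookup (N[ G ] A) u      ≡⟨ lookup-─-∉ (N[ G ] A) A (x∈p─q⇒x∉q (V G) A u∈W) ⟨
    lookup (N[ G ] A ─ A) u  ≡⟨ cong (λ S → lookup S u) ∂A≡∂B ⟩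
    lookup (N[ H ] B ─ B) u  ≡⟨ lookup-─-∉ (N[ H ] B) B (x∈p─q⇒x∉q (V H) B (∈W⇒∈V─B u∈W)) ⟩
    lookup (N[ H ] B) u      ∎

  module _ {FG FH : Subset n} (N[A]⊆FG : N[ G ] A ⊆ FG) (N[B]⊆FH : N[ H ] B ⊆ FH)
    (agree : Agree W FG FH) where

    unforced-agree : ∀ {v} → v ∈ W → N G v ─ FG ≡ N H v ─ FH
    unforced-agree {v} v∈W =
      agree⇒≡ (N─⊆V─ G (⊆-trans (⊆N[] G A) N[A]⊆FG))
              (subst (_ ⊆_) (≡.sym W≡V─B) (N─⊆V─ H (⊆-trans (⊆N[] H B) N[B]⊆FH)))
              (λ {u} u∈W → lookup-─-cong (N G v) FG (N H v) FH u
                 (trans (lookup∘tabulate _ u) (trans (adj-agree v∈W u∈W) (≡.sym (lookup∘tabulate _ u))))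
                 (agree u∈W))

    forcing-agree : ∀ {u} → u ∈ W → ∀ v → active G k FG v ∧ adj G v u ≡ active H k FH v ∧ adj H v u
    forcing-agree {u} u∈W v with v ∈? W
    ... | yes v∈W = cong₂ _∧_
            (cong₂ (λ b S → b ∧ ((1 ≤ᵇ ∣ S ∣) ∧ (∣ S ∣ ≤ᵇ k))) (agree v∈W) (unforced-agree v∈W))
            (adj-agree v∈W u∈W)
    ... | no v∉W = trans (cong (_∧ adj G v u) (inactive G k (N⊆-off G N[A]⊆FG v∉W)))
                         (≡.sym (cong (_∧ adj H v u) (inactive H k (N⊆-off H N[B]⊆FH v∉V─B))))
      where
      v∉V─B : v ∉ V H ─ B
      v∉V─B v∈ = v∉W (subst (v ∈_) (≡.sym W≡V─B) v∈)

    step-agree : Agree W (step G k FG) (step H k FH)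
    step-agree {u} u∈W = begin
      lookup (step G k FG) u                                          ≡⟨ lookup∘tabulate _ u ⟩
      lookup FG u ∨ anyFin (λ v → active G k FG v ∧ adj G v u)
        ≡⟨ cong₂ _∨_ (agree u∈W) (anyFin-cong (forcing-agree u∈W)) ⟩
      lookup FH u ∨ anyFin (λ v → active H k FH v ∧ adj H v u)        ≡⟨ lookup∘tabulate _ u ⟨
      lookup (step H k FH) u                                          ∎

  iter-agree : ∀ {FG FH} → N[ G ] A ⊆ FG → N[ H ] B ⊆ FH → Agree W FG FH →
    ∀ t → Agree W (iter G k t FG) (iter H k t FH)
  iter-agree _ _ agree ℕ.zero = agree
  iter-agree N[A]⊆FG N[B]⊆FH agree (ℕ.suc t) =
    step-agree (⊆-trans N[A]⊆FG (iter-inflationary G k t)) (⊆-trans N[B]⊆FH (iter-inflationary H k t))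
               (iter-agree N[A]⊆FG N[B]⊆FH agree t)

  saturated-agree : ∀ {FG FH} → N[ H ] B ⊆ FH → FH ⊆ V H → Agree W FG FH → FG ≡ V G → FH ≡ V H
  saturated-agree {FH = FH} N[B]⊆FH FH⊆V agree refl = ⊆-antisym FH⊆V V⊆FH
    where
    V⊆FH : V H ⊆ FH
    V⊆FH {x} x∈V with x ∈? B
    ... | yes x∈B = N[B]⊆FH (⊆N[] H B x∈B)
    ... | no  x∉B = lookup⇒[]= x FH (trans (≡.sym (agree x∈W)) ([]=⇒lookup (p─q⊆p _ A x∈W)))
      where
      x∈W : x ∈ W
      x∈W = subst (x ∈_) (≡.sym W≡V─B) (x∈p∧x∉q⇒x∈p─q x∈V x∉B)

  transfer : ∀ {X Y} t → Agree W X Y → Y ⊆ V H → B ⊆ V H →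
    iter G k t (N[ G ] A ∪ X) ≡ V G → iter H k t (N[ H ] B ∪ Y) ≡ V H
  transfer {X} {Y} t agree Y⊆V B⊆V =
    saturated-agree (⊆-trans (p⊆p∪q Y) (iter-inflationary H k t))
                    (iter-⊆V H k t (∪-⊆ (N[]-⊆V H B⊆V) Y⊆V))
                    (iter-agree (p⊆p∪q X) (p⊆p∪q Y) start-agree t)
    where
    start-agree : Agree W (N[ G ] A ∪ X) (N[ H ] B ∪ Y)
    start-agree {u} u∈W = trans (lookup-zipWith _∨_ u (N[ G ] A) X)
      (trans (cong₂ _∨_ (boundary-agree u∈W) (agree u∈W)) (≡.sym (lookup-zipWith _∨_ u (N[ H ] B) Y)))

  module _ {P : Subset n} (P⊆W : P ⊆ W) (B⊆V : B ⊆ V H) where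

    P⊆V : P ⊆ V H
    P⊆V u∈P = p─q⊆p _ B (∈W⇒∈V─B (P⊆W u∈P))

    forcing : IsKForcing G k (N[ G ] A ∪ P) → IsKForcing H k (N[ H ] B ∪ P)
    forcing (_ , t , filled) = ∪-⊆ (N[]-⊆V H B⊆V) P⊆V , t , transfer t (λ _ → refl) P⊆V B⊆V filled

    power-dominating : IsKPowerDominating G k (A ∪ P) → IsKPowerDominating H k (B ∪ P)
    power-dominating (_ , t , filled) = ∪-⊆ B⊆V P⊆V , t ,
      subst (λ S → iter H k t S ≡ V H) (≡.sym (N[]-∪ H B P))
        (transfer t (N[]-agree P⊆W) (N[]-⊆V H P⊆V) B⊆V
          (subst (λ S → iter G k t S ≡ V G) (N[]-∪ G A P) filled))

corollary3p12 : ∀ {n} (k : ℕ) (G H : Graph n) (A B P : Subset n) →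
    A ⊆ V G → B ⊆ V H →
    DeleteEq G A H B →
    N[ G ] A ─ A ≡ N[ H ] B ─ B →
    P ⊆ V G ─ A →
    (IsKPowerDominating G k (A ∪ P) ⇔ IsKPowerDominating H k (B ∪ P)) ×
    (IsKForcing G k (N[ G ] A ∪ P) ⇔ IsKForcing H k (N[ H ] B ∪ P))
corollary3p12 k G H A B P A⊆V B⊆V G-A≡H-B ∂A≡∂B P⊆V─A =
    mk⇔ (G→H.power-dominating P⊆V─A B⊆V) (H→G.power-dominating P⊆V─B A⊆V)
  , mk⇔ (G→H.forcing P⊆V─A B⊆V) (H→G.forcing P⊆V─B A⊆V)
  where
  module G→H = Exchange k G H A B G-A≡H-B ∂A≡∂B
  module H→G = Exchange k H G B A (DeleteEq-sym {G = G} {H} {A} {B} G-A≡H-B) (≡.sym ∂A≡∂B)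

  P⊆V─B : P ⊆ V H ─ B
  P⊆V─B u∈P = G→H.∈W⇒∈V─B (P⊆V─A u∈P)
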